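{- All local rules are locally sound and locally invertible: whenever a local rule instance leads from a sequent $\Delta$ to children $\Gamma_1,\ldots,\Gamma_n$, then for every Kripke model $\mathcal{M}$ and state $w$, $\mathcal{M},w\Vdash\Delta$ if and only if $\mathcal{M},w\Vdash\Gamma_i$ for some $i$.
   Context: PDL syntax $\phi ::= \bot \mid p \mid \lnot\phi \mid \phi\land\phi \mid [\alpha]\phi$, $\alpha ::= a \mid \tau? \mid \alpha\cup\beta \mid \alpha;\beta \mid \alpha^\ast$, standard Kripke semantics; $\mathcal{M},w\Vdash\Gamma$ means all formulas of $\Gamma$ hold at $w$. $\Box(\delta_1\cdots\delta_n,\phi)=[\delta_1]\cdots[\delta_n]\phi$. Unfoldings: $\mathit{Tests}(a)=\emptyset$, $\mathit{Tests}(\tau?)=\{\tau\}$, $\mathit{Tests}(\alpha\cup\beta)=\mathit{Tests}(\alpha;\beta)=\mathit{Tests}(\alpha)\cup\mathit{Tests}(\beta)$, $\mathit{Tests}(\alpha^\ast)=\mathit{Tests}(\alpha)$; for a set $\ell$ of formulas, $P^\ell(a)=\{a\}$, $P^\ell(\tau?)=\{\varepsilon\}$ if $\tau\in\ell$ else $\emptyset$, $P^\ell(\beta\cup\gamma)=P^\ell(\beta)\cup P^\ell(\gamma)$, $P^\ell(\beta;\gamma)=\{\bar\beta\gamma\mid\bar\beta\in P^\ell(\beta)\setminus\{\varepsilon\}\}\cup\{\bar\gamma\mid\bar\gamma\in P^\ell(\gamma),\varepsilon\in P^\ell(\beta)\}$, $P^\ell(\beta^\ast)=\{\varepsilon\}\cup\{\bar\beta\beta^\ast\mid\bar\beta\in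 P^\ell(\beta)\setminus\{\varepsilon\}\}$; $\mathsf{unfold}_\Box(\alpha,\psi)=\{\{\lnot\tau\mid\tau\in\mathit{Tests}(\alpha)\setminus\ell\}\cup\{\Box(\bar\alpha,\psi)\mid\bar\alpha\in P^\ell(\alpha)\}\mid\ell\subseteq\mathit{Tests}(\alpha)\}$. $H_a=\{(\emptyset,a)\}$, $H_{\tau?}=\{(\{\tau\},\varepsilon)\}$, $H_{\alpha\cup\beta}=H_\alpha\cup H_\beta$, $H_{\alpha;\beta}=\{(X,\bar\delta\beta)\mid(X,\bar\delta)\in H_\alpha,\bar\delta\ne\varepsilon\}\cup\{(X\cup Y,\bar\delta)\mid(X,\varepsilon)\in H_\alpha,(Y,\bar\delta)\in H_\beta\}$, $H_{\alpha^\ast}=\{(\emptyset,\varepsilon)\}\cup\{(X,\bar\delta\alpha^\ast)\mid(X,\bar\delta)\in H_\alpha,\bar\delta\ne\varepsilon\}$; $\mathsf{unfold}_\Diamond(\alpha,\psi)=\{X\cup\{\lnot\Box(\bar\delta,\psi)\}\mid(X,\bar\delta)\in H_\alpha\}$. Loading: each program $\alpha$ has a marked copy $\underline\alpha$, with $R_{\underline\alpha}=R_\alpha$; a loaded formula is $\lnot[\underline{\alpha_1}]\cdots[\underline{\alpha_n}]\phi$ ($n\ge1$, $\phi$ unmarked); $\xi$ ranges over PDL formulas and $[\underline{\alpha_1}]\cdots[\underline{\alpha_k}]\phi$; $\underline{\mathsf{unfold}}_\Diamond(\alpha,\xi)=\{X\cup\{\lnot[\underline{\delta_1}]\cdots[\underline{\delta_n}]\xi\}\mid(X,\delta_1\cdots\delta_n)\in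 H_\alpha\}$. A sequent (finite set of possibly loaded formulas) is free if it has no loaded formula; basic if all its formulas have the form $\bot,\lnot\bot,p,\lnot p,[a]\phi,\lnot[a]\phi$ ($a$ atomic). The local rules (principal formula not in the context $\Delta$): $(\lnot)$ $\Delta,\lnot\lnot\phi/\Delta,\phi$; $(\land)$ $\Delta,\phi\land\psi/\Delta,\phi,\psi$; $(\lnot\land)$ $\Delta,\lnot(\phi\land\psi)/\Delta,\lnot\phi\mid\Delta,\lnot\psi$; $(\Box)$ $\Delta,[\alpha]\phi/\{\Delta\cup\Gamma\mid\Gamma\in\mathsf{unfold}_\Box(\alpha,\phi)\}$ ($\alpha$ non-atomic); $(\Diamond)$ $\Delta,\lnot[\alpha]\phi/\{\Delta\cup\Gamma\mid\Gamma\in\mathsf{unfold}_\Diamond(\alpha,\phi)\}$ ($\alpha$ non-atomic); $(\underline\Diamond)$ $\Delta,\lnot[\underline\alpha]\xi/\{\Delta\cup\Gamma\mid\Gamma\in\underline{\mathsf{unfold}}_\Diamond(\alpha,\xi)\}$ ($\alpha$ non-atomic); $(L+)$ $\Delta,\lnot[a][\alpha_1]\cdots[\alpha_n]\phi/\Delta,\lnot[\underline a][\underline{\alpha_1}]\cdots[\underline{\alpha_n}]\phi$ ($\Delta$ free and basic, $n\ge0$ maximal); $(L-)$ $\Delta,\lnot[\underline{\alpha_1}]\cdots[\underline{\alpha_n}]\phi/\Delta,\lnot[\alpha_1]\cdots[\alpha_n]\phi$ ($\Delta$ basic, $n\ge1$). -}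

module Defs where

open import Data.Nat using (ℕ)
open import Data.Nat.Properties using () renaming (_≟_ to _≟ℕ_)
open import Data.Bool using (Bool; true; false; if_then_else_)
open import Data.List using (List; []; _∷_; _++_; [_]; map; concatMap; filterᵇ; null; foldr)
open import Data.Bool.ListAction using (any)
open import Data.Unit using (⊤)
open import Data.List.Membership.Propositional using (_∈_; _∉_)
open import Data.List.Relation.Unary.All using (All)
open import Data.List.Relation.Unary.Any using (Any)
open import Data.Product using (_×_; _,_; ∃; Σ)
open import Data.Sum using (_⊎_)
open import Data.Empty using (⊥)
open import Relation.Nullary using (¬_; Dec; yes; no; does)
open import Relation.Binary.PropositionalEquality using (_≡_; refl)
open import Relation.Binary.Construct.Closure.ReflexiveTransitive using (Star)

mutual
  data Form : Set where
    bot  : Form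
    atom : ℕ → Form
    neg  : Form → Form
    and  : Form → Form → Form
    box  : Prog → Form → Form

  data Prog : Set where
    act   : ℕ → Prog
    test  : Form → Prog
    union : Prog → Prog → Prog
    seq   : Prog → Prog → Prog
    star  : Prog → Prog

mutual
  _≟F_ : (φ ψ : Form) → Dec (φ ≡ ψ)
  bot ≟F bot = yes refl
  atom m ≟F atom n with m ≟ℕ n
  ... | yes refl = yes refl
  ... | no ne = no λ { refl → ne refl }
  neg φ ≟F neg ψ with φ ≟F ψ
  ... | yes refl = yes refl
  ... | no ne = no λ { refl → ne refl }
  and φ₁ φ₂ ≟F and ψ₁ ψ₂ with φ₁ ≟F ψ₁ | φ₂ ≟F ψ₂
  ... | yes refl | yes refl = yes refl
  ... | no ne | _ = no λ { refl → ne refl }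
  ... | _ | no ne = no λ { refl → ne refl }
  box α φ ≟F box β ψ with α ≟P β | φ ≟F ψ
  ... | yes refl | yes refl = yes refl
  ... | no ne | _ = no λ { refl → ne refl }
  ... | _ | no ne = no λ { refl → ne refl }
  bot ≟F (atom _) = no λ ()
  bot ≟F (neg _) = no λ ()
  bot ≟F (and _ _) = no λ ()
  bot ≟F (box _ _) = no λ ()
  (atom _) ≟F bot = no λ ()
  (atom _) ≟F (neg _) = no λ ()
  (atom _) ≟F (and _ _) = no λ ()
  (atom _) ≟F (box _ _) = no λ ()
  (neg _) ≟F bot = no λ ()
  (neg _) ≟F (atom _) = no λ ()
  (neg _) ≟F (and _ _) = no λ ()
  (neg _) ≟F (box _ _) = no λ ()
  (and _ _) ≟F bot = no λ ()
  (and _ _) ≟F (atom _) = no λ ()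
  (and _ _) ≟F (neg _) = no λ ()
  (and _ _) ≟F (box _ _) = no λ ()
  (box _ _) ≟F bot = no λ ()
  (box _ _) ≟F (atom _) = no λ ()
  (box _ _) ≟F (neg _) = no λ ()
  (box _ _) ≟F (and _ _) = no λ ()

  _≟P_ : (α β : Prog) → Dec (α ≡ β)
  act m ≟P act n with m ≟ℕ n
  ... | yes refl = yes refl
  ... | no ne = no λ { refl → ne refl }
  test φ ≟P test ψ with φ ≟F ψ
  ... | yes refl = yes refl
  ... | no ne = no λ { refl → ne refl }
  union φ₁ φ₂ ≟P union ψ₁ ψ₂ with φ₁ ≟P ψ₁ | φ₂ ≟P ψ₂
  ... | yes refl | yes refl = yes refl
  ... | no ne | _ = no λ { refl → ne refl }
  ... | _ | no ne = no λ { refl → ne refl }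
  seq φ₁ φ₂ ≟P seq ψ₁ ψ₂ with φ₁ ≟P ψ₁ | φ₂ ≟P ψ₂
  ... | yes refl | yes refl = yes refl
  ... | no ne | _ = no λ { refl → ne refl }
  ... | _ | no ne = no λ { refl → ne refl }
  star α ≟P star β with α ≟P β
  ... | yes refl = yes refl
  ... | no ne = no λ { refl → ne refl }
  (act _) ≟P (test _) = no λ ()
  (act _) ≟P (union _ _) = no λ ()
  (act _) ≟P (seq _ _) = no λ ()
  (act _) ≟P (star _) = no λ ()
  (test _) ≟P (act _) = no λ ()
  (test _) ≟P (union _ _) = no λ ()
  (test _) ≟P (seq _ _) = no λ ()
  (test _) ≟P (star _) = no λ ()
  (union _ _) ≟P (act _) = no λ ()
  (union _ _) ≟P (test _) = no λ ()
  (union _ _) ≟P (seq _ _) = no λ ()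
  (union _ _) ≟P (star _) = no λ ()
  (seq _ _) ≟P (act _) = no λ ()
  (seq _ _) ≟P (test _) = no λ ()
  (seq _ _) ≟P (union _ _) = no λ ()
  (seq _ _) ≟P (star _) = no λ ()
  (star _) ≟P (act _) = no λ ()
  (star _) ≟P (test _) = no λ ()
  (star _) ≟P (union _ _) = no λ ()
  (star _) ≟P (seq _ _) = no λ ()

Box : List Prog → Form → Form
Box δs φ = foldr box φ δs

IsAtomic : Prog → Set
IsAtomic (act _) = ⊤
IsAtomic _       = ⊥

IsBox : Form → Set
IsBox (box _ _) = ⊤
IsBox _         = ⊥

-- Possibly loaded formulas (elements of sequents).
--   ⌜ φ ⌝            : an ordinary (unloaded) PDL formula φ
--   loaded α αs φ    : the loaded formula ¬[α̲][α̲₁]⋯[α̲ₙ]φ  (φ unmarked),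
--                      i.e. at least one marked box.
-- A formula ξ ∈ {PDL formulas} ∪ {[α̲₁]⋯[α̲ₖ]φ} is represented by the
-- pair (αs , φ) of the list of marked programs and the unmarked φ.

data SF : Set where
  ⌜_⌝    : Form → SF
  loaded : Prog → List Prog → Form → SF

Sequent : Set
Sequent = List SF

negL : List Prog → Form → SF
negL []       φ = ⌜ neg φ ⌝
negL (α ∷ αs) φ = loaded α αs φ

IsLoaded : SF → Set
IsLoaded ⌜ _ ⌝          = ⊥
IsLoaded (loaded _ _ _) = ⊤

Free : Sequent → Set
Free Δ = All (λ f → ¬ IsLoaded f) Δ

-- basic formulas: ⊥, ¬⊥, p, ¬p, [a]φ, ¬[a]φ  (a atomic);
-- a loaded ¬[a̲]ξ with a atomic is also counted as of the form ¬[a]φ.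
data BasicF : SF → Set where
  b-bot    : BasicF ⌜ bot ⌝
  b-negbot : BasicF ⌜ neg bot ⌝
  b-atom   : ∀ p → BasicF ⌜ atom p ⌝
  b-negat  : ∀ p → BasicF ⌜ neg (atom p) ⌝
  b-box    : ∀ a φ → BasicF ⌜ box (act a) φ ⌝
  b-dia    : ∀ a φ → BasicF ⌜ neg (box (act a) φ) ⌝
  b-ldia   : ∀ a αs φ → BasicF (loaded (act a) αs φ)

Basic : Sequent → Set
Basic Δ = All BasicF Δ

Tests : Prog → List Form
Tests (act _)     = []
Tests (test τ)    = [ τ ]
Tests (union α β) = Tests α ++ Tests β
Tests (seq α β)   = Tests α ++ Tests β
Tests (star α)    = Tests α

-- all sub-lists; as sets these are exactly the subsets ℓ ⊆ Tests(α)
sublists : {A : Set} → List A → List (List A)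
sublists []       = [ [] ]
sublists (x ∷ xs) = let s = sublists xs in map (x ∷_) s ++ s

_∈ᵇ_ : Form → List Form → Bool
τ ∈ᵇ ℓ = any (λ σ → does (τ ≟F σ)) ℓ

nonEmpty : {A : Set} → List A → Bool
nonEmpty [] = false
nonEmpty (_ ∷ _) = true

hasEmpty : List (List Prog) → Bool
hasEmpty = any null

Pℓ : List Form → Prog → List (List Prog)
Pℓ ℓ (act a)     = [ [ act a ] ]
Pℓ ℓ (test τ)    = if τ ∈ᵇ ℓ then [ [] ] else []
Pℓ ℓ (union β γ) = Pℓ ℓ β ++ Pℓ ℓ γ
Pℓ ℓ (seq β γ)   = map (λ δ → δ ++ [ γ ]) (filterᵇ nonEmpty (Pℓ ℓ β))
                   ++ (if hasEmpty (Pℓ ℓ β) then Pℓ ℓ γ else [])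
Pℓ ℓ (star β)    = [] ∷ map (λ δ → δ ++ [ star β ]) (filterᵇ nonEmpty (Pℓ ℓ β))

unfoldBox : Prog → Form → List (List Form)
unfoldBox α ψ = map (λ ℓ → map neg (filterᵇ (λ τ → if τ ∈ᵇ ℓ then false else true) (Tests α))
                           ++ map (λ δ → Box δ ψ) (Pℓ ℓ α))
                    (sublists (Tests α))

H : Prog → List (List Form × List Prog)
H (act a)     = [ ([] , [ act a ]) ]
H (test τ)    = [ ([ τ ] , []) ]
H (union α β) = H α ++ H β
H (seq α β)   = concatMap (λ { (X , []) → []
                              ; (X , δ ∷ δs) → [ (X , (δ ∷ δs) ++ [ β ]) ] }) (H α)
                ++ concatMap (λ { (X , []) → map (λ { (Y , δ) → (X ++ Y , δ) }) (H β)
                                ; (X , _ ∷ _) → [] }) (H α)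
H (star α)    = ([] , []) ∷ concatMap (λ { (X , []) → []
                                          ; (X , δ ∷ δs) → [ (X , (δ ∷ δs) ++ [ star α ]) ] }) (H α)

unfoldDia : Prog → Form → List Sequent
unfoldDia α ψ = map (λ { (X , δ) → map ⌜_⌝ X ++ [ ⌜ neg (Box δ ψ) ⌝ ] }) (H α)

unfoldDiaL : Prog → List Prog → Form → List Sequent
unfoldDiaL α βs φ = map (λ { (X , δ) → map ⌜_⌝ X ++ [ negL (δ ++ βs) φ ] }) (H α)

data LocalRule : Sequent → List Sequent → Set where
  r¬  : ∀ Δ φ → ⌜ neg (neg φ) ⌝ ∉ Δ →
        LocalRule (⌜ neg (neg φ) ⌝ ∷ Δ) [ ⌜ φ ⌝ ∷ Δ ]
  r∧  : ∀ Δ φ ψ → ⌜ and φ ψ ⌝ ∉ Δ →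
        LocalRule (⌜ and φ ψ ⌝ ∷ Δ) [ ⌜ φ ⌝ ∷ ⌜ ψ ⌝ ∷ Δ ]
  r¬∧ : ∀ Δ φ ψ → ⌜ neg (and φ ψ) ⌝ ∉ Δ →
        LocalRule (⌜ neg (and φ ψ) ⌝ ∷ Δ) (( ⌜ neg φ ⌝ ∷ Δ) ∷ (⌜ neg ψ ⌝ ∷ Δ) ∷ [])
  r□  : ∀ Δ α φ → ¬ IsAtomic α → ⌜ box α φ ⌝ ∉ Δ →
        LocalRule (⌜ box α φ ⌝ ∷ Δ) (map (λ Γ → Δ ++ map ⌜_⌝ Γ) (unfoldBox α φ))
  r◇  : ∀ Δ α φ → ¬ IsAtomic α → ⌜ neg (box α φ) ⌝ ∉ Δ →
        LocalRule (⌜ neg (box α φ) ⌝ ∷ Δ) (map (Δ ++_) (unfoldDia α φ))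
  r◇L : ∀ Δ α βs φ → ¬ IsAtomic α → loaded α βs φ ∉ Δ →
        LocalRule (loaded α βs φ ∷ Δ) (map (Δ ++_) (unfoldDiaL α βs φ))
  rL+ : ∀ Δ a αs φ → Free Δ → Basic Δ → ¬ IsBox φ →
        ⌜ neg (Box (act a ∷ αs) φ) ⌝ ∉ Δ →
        LocalRule (⌜ neg (Box (act a ∷ αs) φ) ⌝ ∷ Δ) [ loaded (act a) αs φ ∷ Δ ]
  rL- : ∀ Δ α αs φ → Basic Δ → loaded α αs φ ∉ Δ →
        LocalRule (loaded α αs φ ∷ Δ) [ ⌜ neg (Box (α ∷ αs) φ) ⌝ ∷ Δ ]

record Model : Set₁ where
  field
    W : Set
    R : ℕ → W → W → Set
    V : ℕ → W → Set
open Model public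

mutual
  _,_⊨_ : (M : Model) → W M → Form → Set
  M , w ⊨ bot     = ⊥
  M , w ⊨ atom p  = V M p w
  M , w ⊨ neg φ   = ¬ (M , w ⊨ φ)
  M , w ⊨ and φ ψ = (M , w ⊨ φ) × (M , w ⊨ ψ)
  M , w ⊨ box α φ = ∀ v → Rel M α w v → M , v ⊨ φ

  Rel : (M : Model) → Prog → W M → W M → Set
  Rel M (act a)     w v = R M a w v
  Rel M (test τ)    w v = (w ≡ v) × (M , w ⊨ τ)
  Rel M (union α β) w v = Rel M α w v ⊎ Rel M β w v
  Rel M (seq α β)   w v = ∃ λ u → Rel M α w u × Rel M β u v
  Rel M (star α)    w v = Star (Rel M α) w v

-- marked programs have the same relation: R_α̲ = R_α
_,_⊨SF_ : (M : Model) → W M → SF → Set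
M , w ⊨SF ⌜ φ ⌝          = M , w ⊨ φ
M , w ⊨SF loaded α αs φ  = ¬ (M , w ⊨ Box (α ∷ αs) φ)

_,_⊩_ : (M : Model) → W M → Sequent → Set
M , w ⊩ Γ = All (λ f → M , w ⊨SF f) Γ

-- Every rule replaces its principal formula by a disjunction, over the children, of
-- conjunctions, and keeps the context; so it suffices that the principal formula is equivalent
-- at w to that disjunction.  For [α]ψ the witnessing child is the one indexed by the set ℓ of
-- tests of α that are true at w: every α-step from w is then a path along some sequence in
-- P^ℓ(α), and every such path is an α-step.  For ¬[α]ψ, an α-step from w to a
-- counterexample splits as the tests X of some (X, δ̄) ∈ H_α, all true at w, followed by
-- a δ̄-path, and conversely.
-- Excluded middle is needed to choose ℓ, to find the counterexample, and for (¬) and (¬∧).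

module Submission where

open import Defs
open import Axiom.ExcludedMiddle using (ExcludedMiddle)
open import Axiom.DoubleNegationElimination using (DoubleNegationElimination; em⇒dne)
open import Level using (0ℓ)
open import Function using (_∘_)
open import Function.Bundles using (_⇔_; mk⇔; Equivalence)
open import Function.Construct.Composition using (_⇔-∘_)
open import Function.Construct.Identity using (⇔-id)
open import Function.Construct.Symmetry using (⇔-sym)
open import Data.Bool using (Bool; true; false; if_then_else_; T)
open import Data.Bool.Properties using (T?)
open import Data.Unit using (tt)
open import Data.Empty using (⊥-elim)
open import Data.Product using (_×_; _,_; ∃; ∃₂; proj₁; proj₂)
open import Data.Sum using (inj₁; inj₂)
open import Data.List using (List; []; _∷_; _++_; [_]; _∷ʳ_; map; concatMap; filter; filterᵇ; null)
open import Data.List.Properties using (foldr-++)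
open import Data.List.Relation.Unary.All using (All; []; _∷_)
import Data.List.Relation.Unary.All as All
import Data.List.Relation.Unary.All.Properties as AllP
open import Data.List.Relation.Unary.Any using (Any; here; there; satisfied)
import Data.List.Relation.Unary.Any as Any
import Data.List.Relation.Unary.Any.Properties as AnyP
open import Data.List.Membership.Propositional using (_∈_; _∉_; find; lose)
open import Data.List.Membership.DecPropositional _≟F_ using (_∈?_)
open import Data.List.Membership.Propositional.Properties
  using (∈-map⁺; ∈-map⁻; ∈-++⁺ˡ; ∈-++⁺ʳ; ∈-++⁻; ∈-filter⁺; ∈-filter⁻; ∈-concatMap⁺; ∈-concatMap⁻)
open import Relation.Nullary using (¬_; yes; no)
open import Relation.Unary using (Decidable)
open import Relation.Binary.PropositionalEquality using (_≡_; refl; sym)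
open import Relation.Binary.Construct.Closure.ReflexiveTransitive using (ε; _◅_)

open Equivalence using (to; from)

Any-⇔ : {A : Set} {P Q : A → Set} {xs : List A} →
        (∀ {x} → P x ⇔ Q x) → Any P xs ⇔ Any Q xs
Any-⇔ P⇔Q = mk⇔ (Any.map (to P⇔Q)) (Any.map (from P⇔Q))

Any-map⇔ : {A B : Set} {P : A → Set} {Q : B → Set} {f : A → B} {xs : List A} →
           (∀ x → P x ⇔ Q (f x)) → Any P xs ⇔ Any Q (map f xs)
Any-map⇔ P⇔Qf = mk⇔ (AnyP.map⁺ ∘ Any.map (to (P⇔Qf _))) (Any.map (from (P⇔Qf _)) ∘ AnyP.map⁻)

filter∈sublists : {A : Set} {P : A → Set} (P? : Decidable P) (xs : List A) →
                  filter P? xs ∈ sublists xs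
filter∈sublists P? [] = here refl
filter∈sublists P? (x ∷ xs) with P? x
... | yes _ = ∈-++⁺ˡ (∈-map⁺ (x ∷_) (filter∈sublists P? xs))
... | no _  = ∈-++⁺ʳ (map (x ∷_) (sublists xs)) (filter∈sublists P? xs)

∈-if⁺ : {A : Set} {x : A} {xs : List A} (b : Bool) → T b → x ∈ xs → x ∈ (if b then xs else [])
∈-if⁺ true _ x∈xs = x∈xs

∈-if⁻ : {A : Set} {x : A} {xs : List A} (b : Bool) → x ∈ (if b then xs else []) → T b × x ∈ xs
∈-if⁻ true x∈xs = tt , x∈xs

∈ᵇ⇒∈ : ∀ τ ℓ → T (τ ∈ᵇ ℓ) → τ ∈ ℓ
∈ᵇ⇒∈ τ (σ ∷ ℓ) t with τ ≟F σ
... | yes refl = here refl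
... | no _     = there (∈ᵇ⇒∈ τ ℓ t)

∈⇒∈ᵇ : ∀ {τ ℓ} → τ ∈ ℓ → T (τ ∈ᵇ ℓ)
∈⇒∈ᵇ {τ} (here refl) with τ ≟F τ
... | yes _   = tt
... | no τ≢τ  = ⊥-elim (τ≢τ refl)
∈⇒∈ᵇ {τ} {σ ∷ _} (there τ∈ℓ) with τ ≟F σ
... | yes _ = tt
... | no _  = ∈⇒∈ᵇ τ∈ℓ

[]∈⇒hasEmpty : ∀ {δs} → [] ∈ δs → T (hasEmpty δs)
[]∈⇒hasEmpty = AnyP.any⁺ null ∘ Any.map λ { refl → tt }

hasEmpty⇒[]∈ : ∀ δs → T (hasEmpty δs) → [] ∈ δs
hasEmpty⇒[]∈ δs = Any.map null⇒[]≡ ∘ AnyP.any⁻ null δs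
  where
  null⇒[]≡ : ∀ {δ : List Prog} → T (null δ) → [] ≡ δ
  null⇒[]≡ {[]} _ = refl

infixl 5 _∖_
_∖_ : List Form → List Form → List Form
xs ∖ ℓ = filterᵇ (λ τ → if τ ∈ᵇ ℓ then false else true) xs

T-if-not⁺ : ∀ b → ¬ T b → T (if b then false else true)
T-if-not⁺ false _  = tt
T-if-not⁺ true ¬tt = ¬tt tt

T-if-not⁻ : ∀ b → T (if b then false else true) → ¬ T b
T-if-not⁻ false _ ()

∈-∖⁺ : ∀ {τ xs ℓ} → τ ∈ xs → τ ∉ ℓ → τ ∈ xs ∖ ℓ
∈-∖⁺ {τ} {ℓ = ℓ} τ∈xs τ∉ℓ = ∈-filter⁺ _ τ∈xs (T-if-not⁺ (τ ∈ᵇ ℓ) (τ∉ℓ ∘ ∈ᵇ⇒∈ τ ℓ))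

∈-∖⁻ : ∀ {τ xs ℓ} → τ ∈ xs ∖ ℓ → τ ∈ xs × τ ∉ ℓ
∈-∖⁻ {τ} {ℓ = ℓ} τ∈xs∖ℓ =
  let τ∈xs , outside = ∈-filter⁻ _ τ∈xs∖ℓ in τ∈xs , T-if-not⁻ (τ ∈ᵇ ℓ) outside ∘ ∈⇒∈ᵇ

Box-++ : ∀ δs βs φ → Box (δs ++ βs) φ ≡ Box δs (Box βs φ)
Box-++ δs βs φ = foldr-++ box φ δs βs

unfoldBoxℓ : List Form → Prog → Form → List Form
unfoldBoxℓ ℓ α ψ = map neg (Tests α ∖ ℓ) ++ map (λ δ → Box δ ψ) (Pℓ ℓ α)

module Unfolding (M : Model) where

  RelSeq : List Prog → W M → W M → Set
  RelSeq []       w v = w ≡ v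
  RelSeq (α ∷ δs) w v = ∃ λ u → Rel M α w u × RelSeq δs u v

  Box-elim : ∀ δs {φ w v} → M , w ⊨ Box δs φ → RelSeq δs w v → M , v ⊨ φ
  Box-elim []       w⊨φ refl        = w⊨φ
  Box-elim (α ∷ δs) w⊨□ (u , r , s) = Box-elim δs (w⊨□ u r) s

  Box-intro : ∀ δs {φ w} → (∀ v → RelSeq δs w v → M , v ⊨ φ) → M , w ⊨ Box δs φ
  Box-intro []       h = h _ refl
  Box-intro (α ∷ δs) h = λ u r → Box-intro δs λ v s → h v (u , r , s)

  RelSeq-∷ʳ⁺ : ∀ δs γ {w u v} → RelSeq δs w u → Rel M γ u v → RelSeq (δs ∷ʳ γ) w v
  RelSeq-∷ʳ⁺ []       γ refl        r′ = _ , r′ , refl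
  RelSeq-∷ʳ⁺ (_ ∷ δs) γ (u , r , s) r′ = u , r , RelSeq-∷ʳ⁺ δs γ s r′

  RelSeq-∷ʳ⁻ : ∀ δs {γ w v} → RelSeq (δs ∷ʳ γ) w v → ∃ λ u → RelSeq δs w u × Rel M γ u v
  RelSeq-∷ʳ⁻ []       (_ , r , refl) = _ , refl , r
  RelSeq-∷ʳ⁻ (_ ∷ δs) (u , r , s)    =
    let u′ , s′ , r′ = RelSeq-∷ʳ⁻ δs s in u′ , (u , r , s′) , r′

  module _ (ℓ : List Form) where

    Pℓ-complete : ∀ α {w v} → (∀ {τ} → τ ∈ Tests α → M , w ⊨ τ → τ ∈ ℓ) →
                  Rel M α w v → ∃ λ δ → δ ∈ Pℓ ℓ α × RelSeq δ w v
    Pℓ-complete (act a) _ r = [ act a ] , here refl , (_ , r , refl)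
    Pℓ-complete (test τ) true∈ℓ (refl , t) =
      [] , ∈-if⁺ (τ ∈ᵇ ℓ) (∈⇒∈ᵇ (true∈ℓ (here refl) t)) (here refl) , refl
    Pℓ-complete (union β γ) true∈ℓ (inj₁ r) =
      let δ , δ∈ , s = Pℓ-complete β (true∈ℓ ∘ ∈-++⁺ˡ) r in δ , ∈-++⁺ˡ δ∈ , s
    Pℓ-complete (union β γ) true∈ℓ (inj₂ r) =
      let δ , δ∈ , s = Pℓ-complete γ (true∈ℓ ∘ ∈-++⁺ʳ (Tests β)) r in δ , ∈-++⁺ʳ (Pℓ ℓ β) δ∈ , s
    Pℓ-complete (seq β γ) true∈ℓ (u , r₁ , r₂) with Pℓ-complete β (true∈ℓ ∘ ∈-++⁺ˡ) r₁
    ... | [] , []∈ , refl =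
      let δ , δ∈ , s = Pℓ-complete γ (true∈ℓ ∘ ∈-++⁺ʳ (Tests β)) r₂
      in δ , ∈-++⁺ʳ _ (∈-if⁺ (hasEmpty (Pℓ ℓ β)) ([]∈⇒hasEmpty []∈) δ∈) , s
    ... | δ@(_ ∷ _) , δ∈ , s =
      δ ∷ʳ γ , ∈-++⁺ˡ (∈-map⁺ _ (∈-filter⁺ (T? ∘ nonEmpty) δ∈ tt)) , RelSeq-∷ʳ⁺ δ γ s r₂
    Pℓ-complete (star β) _ ε = [] , here refl , refl
    Pℓ-complete (star β) true∈ℓ (r ◅ rs) with Pℓ-complete β true∈ℓ r
    -- An iteration realised by ε stays at w, so the hypothesis on the tests at w
    -- still covers the remaining iterations.
    ... | [] , _ , refl = Pℓ-complete (star β) true∈ℓ rs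
    ... | δ@(_ ∷ _) , δ∈ , s =
      δ ∷ʳ star β , there (∈-map⁺ _ (∈-filter⁺ (T? ∘ nonEmpty) δ∈ tt)) , RelSeq-∷ʳ⁺ δ (star β) s rs

    Pℓ-sound : ∀ α {δ w v} → (∀ {τ} → τ ∈ ℓ → M , w ⊨ τ) →
               δ ∈ Pℓ ℓ α → RelSeq δ w v → Rel M α w v
    Pℓ-sound (act a) _ (here refl) (_ , r , refl) = r
    Pℓ-sound (test τ) ℓ-true δ∈ s with ∈-if⁻ (τ ∈ᵇ ℓ) δ∈
    ... | τ∈ᵇℓ , here refl = s , ℓ-true (∈ᵇ⇒∈ τ ℓ τ∈ᵇℓ)
    Pℓ-sound (union β γ) ℓ-true δ∈ s with ∈-++⁻ (Pℓ ℓ β) δ∈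
    ... | inj₁ δ∈β = inj₁ (Pℓ-sound β ℓ-true δ∈β s)
    ... | inj₂ δ∈γ = inj₂ (Pℓ-sound γ ℓ-true δ∈γ s)
    Pℓ-sound (seq β γ) ℓ-true δ∈ s with ∈-++⁻ (map (_∷ʳ γ) (filterᵇ nonEmpty (Pℓ ℓ β))) δ∈
    ... | inj₁ δ∈₁ with ∈-map⁻ _ δ∈₁
    ...   | δ′ , δ′∈ , refl =
      let u , s′ , r = RelSeq-∷ʳ⁻ δ′ s in u , Pℓ-sound β ℓ-true (proj₁ (∈-filter⁻ _ δ′∈)) s′ , r
    Pℓ-sound (seq β γ) ℓ-true δ∈ s | inj₂ δ∈₂ =
      let has[] , δ∈γ = ∈-if⁻ (hasEmpty (Pℓ ℓ β)) δ∈₂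
      in _ , Pℓ-sound β ℓ-true (hasEmpty⇒[]∈ (Pℓ ℓ β) has[]) refl , Pℓ-sound γ ℓ-true δ∈γ s
    Pℓ-sound (star β) _ (here refl) refl = ε
    Pℓ-sound (star β) ℓ-true (there δ∈) s with ∈-map⁻ _ δ∈
    ... | δ′ , δ′∈ , refl =
      let u , s′ , rs = RelSeq-∷ʳ⁻ δ′ s in Pℓ-sound β ℓ-true (proj₁ (∈-filter⁻ _ δ′∈)) s′ ◅ rs

  H-complete : ∀ α {w v} → Rel M α w v →
               ∃₂ λ X δ → (X , δ) ∈ H α × All (M , w ⊨_) X × RelSeq δ w v
  H-complete (act a) r = [] , [ act a ] , here refl , [] , (_ , r , refl)
  H-complete (test τ) (refl , t) = [ τ ] , [] , here refl , t ∷ [] , refl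
  H-complete (union β γ) (inj₁ r) =
    let X , δ , ∈H , X-true , s = H-complete β r in X , δ , ∈-++⁺ˡ ∈H , X-true , s
  H-complete (union β γ) (inj₂ r) =
    let X , δ , ∈H , X-true , s = H-complete γ r in X , δ , ∈-++⁺ʳ (H β) ∈H , X-true , s
  H-complete (seq β γ) (u , r₁ , r₂) with H-complete β r₁
  ... | X , [] , ∈H , X-true , refl =
    let Y , δ , ∈H′ , Y-true , s = H-complete γ r₂
    in X ++ Y , δ , ∈-++⁺ʳ _ (∈-concatMap⁺ _ (lose ∈H (∈-map⁺ _ ∈H′))) , AllP.++⁺ X-true Y-true , s
  ... | X , δ@(_ ∷ _) , ∈H , X-true , s =
    X , δ ∷ʳ γ , ∈-++⁺ˡ (∈-concatMap⁺ _ (lose ∈H (here refl))) , X-true , RelSeq-∷ʳ⁺ δ γ s r₂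
  H-complete (star β) ε = [] , [] , here refl , [] , refl
  H-complete (star β) (r ◅ rs) with H-complete β r
  ... | _ , [] , _ , _ , refl = H-complete (star β) rs
  ... | X , δ@(_ ∷ _) , ∈H , X-true , s =
    X , δ ∷ʳ star β , there (∈-concatMap⁺ _ (lose ∈H (here refl))) , X-true , RelSeq-∷ʳ⁺ δ (star β) s rs

  H-sound : ∀ α {X δ w v} → (X , δ) ∈ H α → All (M , w ⊨_) X → RelSeq δ w v → Rel M α w v
  H-sound (act a) (here refl) [] (_ , r , refl) = r
  H-sound (test τ) (here refl) (t ∷ []) refl = refl , t
  H-sound (union β γ) ∈H X-true s with ∈-++⁻ (H β) ∈H
  ... | inj₁ ∈Hβ = inj₁ (H-sound β ∈Hβ X-true s)
  ... | inj₂ ∈Hγ = inj₂ (H-sound γ ∈Hγ X-true s)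
  H-sound (seq β γ) ∈H X-true s with ∈-++⁻ (concatMap _ (H β)) ∈H
  ... | inj₁ ∈H₁ with find (∈-concatMap⁻ _ {H β} ∈H₁)
  ...   | (_ , δ′@(_ ∷ _)) , ∈Hβ , here refl =
    let u , s′ , r = RelSeq-∷ʳ⁻ δ′ s in u , H-sound β ∈Hβ X-true s′ , r
  H-sound (seq β γ) ∈H X-true s | inj₂ ∈H₂ with find (∈-concatMap⁻ _ {H β} ∈H₂)
  ... | (X′ , []) , ∈Hβ , ∈map with ∈-map⁻ _ ∈map
  ...   | _ , ∈Hγ , refl =
    _ , H-sound β ∈Hβ (AllP.++⁻ˡ X′ X-true) refl , H-sound γ ∈Hγ (AllP.++⁻ʳ X′ X-true) s
  H-sound (star β) (here refl) [] refl = ε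
  H-sound (star β) (there ∈H) X-true s with find (∈-concatMap⁻ _ {H β} ∈H)
  ... | (_ , δ′@(_ ∷ _)) , ∈Hβ , here refl =
    let u , s′ , rs = RelSeq-∷ʳ⁻ δ′ s in H-sound β ∈Hβ X-true s′ ◅ rs

  unfoldBoxℓ⇒⊨box : ∀ ℓ α ψ {w} → All (M , w ⊨_) (unfoldBoxℓ ℓ α ψ) → M , w ⊨ box α ψ
  unfoldBoxℓ⇒⊨box ℓ α ψ {w} ⊨ℓ v r =
    let δ , δ∈ , s = Pℓ-complete ℓ α true∈ℓ r in Box-elim δ (All.lookup boxes δ∈) s
    where
    negs : All (λ τ → ¬ M , w ⊨ τ) (Tests α ∖ ℓ)
    negs = AllP.map⁻ (AllP.++⁻ˡ _ ⊨ℓ)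
    boxes : All (λ δ → M , w ⊨ Box δ ψ) (Pℓ ℓ α)
    boxes = AllP.map⁻ (AllP.++⁻ʳ _ ⊨ℓ)
    true∈ℓ : ∀ {τ} → τ ∈ Tests α → M , w ⊨ τ → τ ∈ ℓ
    true∈ℓ {τ} τ∈ t with τ ∈? ℓ
    ... | yes τ∈ℓ = τ∈ℓ
    ... | no τ∉ℓ  = ⊥-elim (All.lookup negs (∈-∖⁺ τ∈ τ∉ℓ) t)

  H-witness⇒⊭box : ∀ α ψ {w} →
    Any (λ (X , δ) → All (M , w ⊨_) X × ¬ M , w ⊨ Box δ ψ) (H α) → ¬ M , w ⊨ box α ψ
  H-witness⇒⊭box α ψ witness w⊨□ =
    let (_ , δ) , ∈H , X-true , ⊭Box = find witness
    in ⊭Box (Box-intro δ λ v s → w⊨□ v (H-sound α ∈H X-true s))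

module _ {M : Model} {w : W M} where

  ⊩-map⌜⌝⇔ : ∀ {Γ} → (M , w ⊩ map ⌜_⌝ Γ) ⇔ All (M , w ⊨_) Γ
  ⊩-map⌜⌝⇔ = mk⇔ AllP.map⁻ AllP.map⁺

  ⊩-tests-∷ʳ : ∀ {X f} {B : Set} → (M , w ⊨SF f) ⇔ B →
               (M , w ⊩ (map ⌜_⌝ X ++ [ f ])) ⇔ (All (M , w ⊨_) X × B)
  ⊩-tests-∷ʳ {X} f⇔B = mk⇔
    (λ ⊩Γ → let X-true , ⊩f = AllP.++⁻ (map ⌜_⌝ X) ⊩Γ in AllP.map⁻ X-true , to f⇔B (All.head ⊩f))
    (λ (X-true , b) → AllP.++⁺ (AllP.map⁺ X-true) (from f⇔B b ∷ []))

  ⊨negL-++⇔ : ∀ δs βs φ → (M , w ⊨SF negL (δs ++ βs) φ) ⇔ (¬ M , w ⊨ Box δs (Box βs φ))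
  ⊨negL-++⇔ δs βs φ rewrite sym (Box-++ δs βs φ) = ⊨negL⇔ (δs ++ βs)
    where
    ⊨negL⇔ : ∀ γs → (M , w ⊨SF negL γs φ) ⇔ (¬ M , w ⊨ Box γs φ)
    ⊨negL⇔ []      = ⇔-id _
    ⊨negL⇔ (_ ∷ _) = ⇔-id _

  in-context-left : {A : Set} {f : SF} {Δ : Sequent} (g : A → Sequent) {L : List A} →
                    (M , w ⊨SF f) ⇔ Any (λ a → M , w ⊩ g a) L →
                    (M , w ⊩ (f ∷ Δ)) ⇔ Any (M , w ⊩_) (map (λ a → Δ ++ g a) L)
  in-context-left {Δ = Δ} g principal = mk⇔
    (λ { (f-true ∷ Δ-true) → AnyP.map⁺ (Any.map (AllP.++⁺ Δ-true) (to principal f-true)) })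
    (λ some-child → let some-child′ = AnyP.map⁻ some-child in
      from principal (Any.map (AllP.++⁻ʳ Δ) some-child′) ∷ AllP.++⁻ˡ Δ (proj₂ (satisfied some-child′)))

  in-context-right : ∀ {f Δ Γs} → (M , w ⊨SF f) ⇔ Any (M , w ⊩_) Γs →
                     (M , w ⊩ (f ∷ Δ)) ⇔ Any (M , w ⊩_) (map (_++ Δ) Γs)
  in-context-right {Δ = Δ} principal = mk⇔
    (λ { (f-true ∷ Δ-true) → AnyP.map⁺ (Any.map (λ ⊩Γ → AllP.++⁺ ⊩Γ Δ-true) (to principal f-true)) })
    (λ some-child → let some-child′ = AnyP.map⁻ some-child in
      from principal (Any.map (AllP.++⁻ˡ _) some-child′) ∷ AllP.++⁻ʳ _ (proj₂ (satisfied some-child′)))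

  single-child : ∀ {f Δ} Γ → (M , w ⊨SF f) ⇔ (M , w ⊩ Γ) →
                 (M , w ⊩ (f ∷ Δ)) ⇔ Any (M , w ⊩_) [ Γ ++ Δ ]
  single-child Γ principal =
    in-context-right (mk⇔ (here ∘ to principal) (from principal ∘ AnyP.singleton⁻))

module Classical (em : ExcludedMiddle 0ℓ) (M : Model) where
  open Unfolding M

  _⊨?_ : ∀ w → Decidable (M , w ⊨_)
  w ⊨? τ = em

  dne : DoubleNegationElimination 0ℓ
  dne = em⇒dne em

  counterexample : {A : Set} {P Q : A → Set} → ¬ (∀ x → P x → Q x) → ∃ λ x → P x × ¬ Q x
  counterexample ¬∀ = dne λ ¬∃ → ¬∀ λ x p → dne λ ¬q → ¬∃ (x , p , ¬q)

  ⊨box⇒unfoldBoxℓ : ∀ α ψ {w} → M , w ⊨ box α ψ →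
                    All (M , w ⊨_) (unfoldBoxℓ (filter (w ⊨?_) (Tests α)) α ψ)
  ⊨box⇒unfoldBoxℓ α ψ {w} w⊨□ = AllP.++⁺ (AllP.map⁺ negs) (AllP.map⁺ boxes)
    where
    ℓ : List Form
    ℓ = filter (w ⊨?_) (Tests α)
    negs : All (λ τ → ¬ M , w ⊨ τ) (Tests α ∖ ℓ)
    negs = All.tabulate λ τ∈ t →
      let τ∈α , τ∉ℓ = ∈-∖⁻ {xs = Tests α} τ∈ in τ∉ℓ (∈-filter⁺ (w ⊨?_) τ∈α t)
    boxes : All (λ δ → M , w ⊨ Box δ ψ) (Pℓ ℓ α)
    boxes = All.tabulate λ δ∈ → Box-intro _ λ v s →
      w⊨□ v (Pℓ-sound ℓ α (proj₂ ∘ ∈-filter⁻ (w ⊨?_) {xs = Tests α}) δ∈ s)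

  ⊨box⇔unfoldBox : ∀ α ψ {w} → (M , w ⊨ box α ψ) ⇔ Any (All (M , w ⊨_)) (unfoldBox α ψ)
  ⊨box⇔unfoldBox α ψ {w} = mk⇔
    (λ w⊨□ → AnyP.map⁺ (lose (filter∈sublists (w ⊨?_) (Tests α)) (⊨box⇒unfoldBoxℓ α ψ w⊨□)))
    (λ ⊨some-ℓ → let ℓ , ⊨ℓ = satisfied (AnyP.map⁻ ⊨some-ℓ) in unfoldBoxℓ⇒⊨box ℓ α ψ ⊨ℓ)

  ⊭box⇔H : ∀ α ψ {w} →
           (¬ M , w ⊨ box α ψ) ⇔ Any (λ (X , δ) → All (M , w ⊨_) X × ¬ M , w ⊨ Box δ ψ) (H α)
  ⊭box⇔H α ψ = mk⇔ witness (H-witness⇒⊭box α ψ)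
    where
    witness : ∀ {w} → ¬ M , w ⊨ box α ψ →
              Any (λ (X , δ) → All (M , w ⊨_) X × ¬ M , w ⊨ Box δ ψ) (H α)
    witness ⊭□ =
      let v , r , ⊭ψ = counterexample ⊭□
          X , δ , ∈H , X-true , s = H-complete α r
      in lose ∈H (X-true , λ ⊨Box → ⊭ψ (Box-elim δ ⊨Box s))

  ⊭box⇔unfoldDia : ∀ α ψ {w} → (¬ M , w ⊨ box α ψ) ⇔ Any (M , w ⊩_) (unfoldDia α ψ)
  ⊭box⇔unfoldDia α ψ = Any-map⇔ (λ _ → ⇔-sym (⊩-tests-∷ʳ (⇔-id _))) ⇔-∘ ⊭box⇔H α ψ

  ⊨loaded⇔unfoldDiaL : ∀ α βs φ {w} →
                       (M , w ⊨SF loaded α βs φ) ⇔ Any (M , w ⊩_) (unfoldDiaL α βs φ)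
  ⊨loaded⇔unfoldDiaL α βs φ =
    Any-map⇔ (λ (_ , δ) → ⇔-sym (⊩-tests-∷ʳ (⊨negL-++⇔ δ βs φ))) ⇔-∘ ⊭box⇔H α (Box βs φ)

  ⊭and⇔ : ∀ φ ψ {w} → (¬ M , w ⊨ and φ ψ) ⇔ Any (M , w ⊩_) ([ ⌜ neg φ ⌝ ] ∷ [ ⌜ neg ψ ⌝ ] ∷ [])
  ⊭and⇔ φ ψ {w} = mk⇔ split join
    where
    split : ¬ M , w ⊨ and φ ψ → Any (M , w ⊩_) ([ ⌜ neg φ ⌝ ] ∷ [ ⌜ neg ψ ⌝ ] ∷ [])
    split ⊭φ∧ψ with w ⊨? φ
    ... | yes ⊨φ = there (here ((λ ⊨ψ → ⊭φ∧ψ (⊨φ , ⊨ψ)) ∷ []))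
    ... | no ⊭φ  = here (⊭φ ∷ [])
    join : Any (M , w ⊩_) ([ ⌜ neg φ ⌝ ] ∷ [ ⌜ neg ψ ⌝ ] ∷ []) → ¬ M , w ⊨ and φ ψ
    join (here (⊭φ ∷ []))         (⊨φ , _) = ⊭φ ⊨φ
    join (there (here (⊭ψ ∷ []))) (_ , ⊨ψ) = ⊭ψ ⊨ψ

lemma3p35 : ExcludedMiddle 0ℓ →
    ∀ (Δ : Sequent) (children : List Sequent) → LocalRule Δ children →
    ∀ (M : Model) (w : W M) →
    (M , w ⊩ Δ) ⇔ Any (λ Γ → M , w ⊩ Γ) children
lemma3p35 em _ _ rule M w = invertible rule
  where
  open Classical em M
  invertible : ∀ {Δ children} → LocalRule Δ children → (M , w ⊩ Δ) ⇔ Any (M , w ⊩_) children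
  invertible (r¬ _ φ _) =
    single-child [ ⌜ φ ⌝ ] (mk⇔ (λ ⊭⊭φ → dne ⊭⊭φ ∷ []) λ { (⊨φ ∷ []) ⊭φ → ⊭φ ⊨φ })
  invertible (r∧ _ φ ψ _) =
    single-child (⌜ φ ⌝ ∷ ⌜ ψ ⌝ ∷ [])
      (mk⇔ (λ { (⊨φ , ⊨ψ) → ⊨φ ∷ ⊨ψ ∷ [] }) λ { (⊨φ ∷ ⊨ψ ∷ []) → ⊨φ , ⊨ψ })
  invertible (r¬∧ _ φ ψ _) = in-context-right (⊭and⇔ φ ψ)
  invertible (r□ _ α φ _ _) =
    in-context-left (map ⌜_⌝) (Any-⇔ (⇔-sym ⊩-map⌜⌝⇔) ⇔-∘ ⊨box⇔unfoldBox α φ)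
  invertible (r◇ _ α φ _ _) = in-context-left (λ Γ → Γ) (⊭box⇔unfoldDia α φ)
  invertible (r◇L _ α βs φ _ _) = in-context-left (λ Γ → Γ) (⊨loaded⇔unfoldDiaL α βs φ)
  invertible (rL+ _ a αs φ _ _ _ _) = single-child [ loaded (act a) αs φ ] (mk⇔ (_∷ []) All.head)
  invertible (rL- _ α αs φ _ _) = single-child [ ⌜ neg (Box (α ∷ αs) φ) ⌝ ] (mk⇔ (_∷ []) All.head)
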